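{- Let $r,s\in\mathbb N$ with $r\ge 2s+1$, and let $a_1,\dots,a_{2s}\in[1,r-1]$ with $a_i<a_{i+1}$ for $i=1,\dots,2s-1$. Let $x_i=\sum_{j=1}^{i}a_{2j}-\sum_{j=0}^{i-1}a_{2j+1}$ for $i=1,\dots,s$, $y_1=r-a_1$, and $y_i=r+\sum_{j=1}^{i-1}a_{2j}-\sum_{j=0}^{i-1}a_{2j+1}$ for $i=2,\dots,s$. Then $0<x_1<\dots<x_s<y_s<\dots<y_1<r$ and the residue classes of $0,x_1,\dots,x_s,y_1,\dots,y_s$ in $\mathbb Z_r$ are pairwise distinct.
   Context: $\mathbb N=\{0,1,2,\dots\}$; $[a,b]=\{x\in\mathbb N: a\le x\le b\}$. -}

module Defs where

open import Data.Nat using (ℕ; zero; suc; _*_; _∸_)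
open import Data.Integer using (ℤ; +_; _+_; _-_; _<_)
open import Data.Integer.Divisibility using (_∣_)
open import Data.List using (List; []; _∷_; _++_; map; upTo; [_])
open import Relation.Nullary using (¬_)

-- Σ[j=m..n] f j  (empty if n < m), computed in ℤ; upper bound given as count
-- sumFrom m k f = f m + f (m+1) + ... + f (m+k-1)
sumFrom : ℕ → ℕ → (ℕ → ℤ) → ℤ
sumFrom m zero    f = + 0
sumFrom m (suc k) f = f m + sumFrom (suc m) k f

-- a is indexed from 1: a 1, ..., a (2s).  Values at other indices are irrelevant.
-- x_i = Σ_{j=1}^{i} a_{2j} - Σ_{j=0}^{i-1} a_{2j+1}
xval : (ℕ → ℕ) → ℕ → ℤ
xval a i = sumFrom 1 i (λ j → + a (2 * j)) - sumFrom 0 i (λ j → + a (suc (2 * j)))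

yval : ℕ → (ℕ → ℕ) → ℕ → ℤ
yval r a (suc zero) = + r - + a 1
yval r a i = + r + sumFrom 1 (i ∸ 1) (λ j → + a (2 * j)) - sumFrom 0 i (λ j → + a (suc (2 * j)))

xs : (ℕ → ℕ) → ℕ → List ℤ
xs a s = map (λ i → xval a (suc i)) (upTo s)

ys : ℕ → (ℕ → ℕ) → ℕ → List ℤ
ys r a s = map (λ i → yval r a (suc i)) (upTo s)

ysRev : ℕ → (ℕ → ℕ) → ℕ → List ℤ
ysRev r a s = map (λ i → yval r a (s ∸ i)) (upTo s)

chain : ℕ → (ℕ → ℕ) → ℕ → List ℤ
chain r a s = (+ 0 ∷ xs a s) ++ (ysRev r a s ++ [ + r ])

points : ℕ → (ℕ → ℕ) → ℕ → List ℤ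
points r a s = + 0 ∷ (xs a s ++ ys r a s)

DistinctMod : ℕ → ℤ → ℤ → Set
DistinctMod r u v = ¬ (+ r ∣ (u - v))

{-# OPTIONS --safe #-}
module Submission where

-- With y₀ = r the recurrences are x_{i+1} = x_i + (a_{2i+2} − a_{2i+1}) and
-- y_{i+1} = x_i + (r − a_{2i+1}) = x_{i+1} + (r − a_{2i+2}).  Since the a_i
-- increase, x increases and y decreases, and x_s < y_s because a_{2s} < r, so
-- 0 = x₀ < x₁ < … < x_s < y_s < … < y₁ < y₀ = r.  All the points therefore lie
-- in [0, r) and are pairwise different, hence different modulo r.

open import Defs
open import Data.Nat using (ℕ; suc; _*_; _+_; _≤_; _<_; _∸_)
open import Data.Product using (_×_; _,_; proj₁; proj₂)
open import Data.Integer using () renaming (_<_ to _<ℤ_)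
open import Data.List.Relation.Unary.Linked using (Linked)
open import Data.List.Relation.Unary.AllPairs using (AllPairs)
open import Data.Nat using (zero; z≤n; s≤s; s<s⁻¹; >-nonZero)
import Data.Nat.Properties as ℕ
import Data.Nat.Divisibility as ℕ
open import Data.Integer as ℤ using (ℤ; +_; +0; +<+)
  renaming (_+_ to _+ℤ_; _-_ to _-ℤ_; _≤_ to _≤ℤ_)
import Data.Integer.Properties as ℤ
open import Data.Integer.Tactic.RingSolver using (solve-∀)
open import Data.List using (_∷_; _++_; [_]; map; upTo)
open import Data.List.Relation.Unary.All as All using (All)
import Data.List.Relation.Unary.All.Properties as All
import Data.List.Relation.Unary.AllPairs as AllPairs
import Data.List.Relation.Unary.AllPairs.Properties as AllPairs
open import Data.List.Relation.Unary.Linked.Properties using (AllPairs⇒Linked)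
open import Data.Sum using (inj₁; inj₂)
open import Function using (id; _∘_; flip)
open import Relation.Binary.Core using (Rel)
open import Relation.Binary.Definitions using (Transitive)
open import Relation.Binary.PropositionalEquality
  using (_≡_; refl; sym; trans; cong; cong₂; subst; module ≡-Reasoning)
open import Relation.Unary using (Pred)

module _ {a ℓ} {A : Set a} {R : Rel A ℓ} (R-trans : Transitive R) {f : ℕ → A} {n : ℕ}
         (step : ∀ {k} → suc k < n → R (f k) (f (suc k))) where

  stepwise⇒pairwise : ∀ {i j} → i < j → j < n → R (f i) (f j)
  stepwise⇒pairwise {i} {suc j} i<1+j 1+j<n with ℕ.m<1+n⇒m<n∨m≡n i<1+j
  ... | inj₂ refl = step 1+j<n
  ... | inj₁ i<j  = R-trans (stepwise⇒pairwise i<j (ℕ.<-trans (ℕ.n<1+n j) 1+j<n)) (step 1+j<n)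

module _ {a} {A : Set a} {f : ℕ → A} {n : ℕ} where

  All-map-upTo⁺ : ∀ {p} {P : Pred A p} → (∀ {i} → i < n → P (f i)) → All P (map f (upTo n))
  All-map-upTo⁺ Pf = All.map⁺ (All.applyUpTo⁺₁ id n Pf)

  AllPairs-map-upTo⁺ : ∀ {ℓ} {R : Rel A ℓ} → (∀ {i j} → i < j → j < n → R (f i) (f j))
                     → AllPairs R (map f (upTo n))
  AllPairs-map-upTo⁺ Rf = AllPairs.map⁺ (AllPairs.applyUpTo⁺₁ id n Rf)

m≤n∸1⇒m<n : ∀ {m n} → 0 < n → m ≤ n ∸ 1 → m < n
m≤n∸1⇒m<n {n = suc _} _ m≤n = s≤s m≤n

m<n⇒0<n-m : ∀ {m n} → m < n → +0 <ℤ + n -ℤ + m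
m<n⇒0<n-m {m} {n} m<n = subst (+0 <ℤ_) (sym n-m≡n∸m) (+<+ (ℕ.m<n⇒0<n∸m m<n))
  where
  n-m≡n∸m : + n -ℤ + m ≡ + (n ∸ m)
  n-m≡n∸m = trans (ℤ.m-n≡m⊖n n m) (ℤ.≤-⊖ (ℕ.<⇒≤ m<n))

0<j⇒i<i+j : ∀ i {j} → +0 <ℤ j → i <ℤ i +ℤ j
0<j⇒i<i+j i {j} 0<j = subst (_<ℤ i +ℤ j) (ℤ.+-identityʳ i) (ℤ.+-monoʳ-< i 0<j)

m<n⇒k-n<k-m : ∀ k {m n} → m < n → k -ℤ + n <ℤ k -ℤ + m
m<n⇒k-n<k-m k m<n = ℤ.+-monoʳ-< k (ℤ.neg-mono-< (+<+ m<n))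

distinctMod-< : ∀ r {u v} → +0 ≤ℤ u → u <ℤ v → v <ℤ + r → DistinctMod r u v
distinctMod-< r {+ m} {+ n} _ (+<+ m<n) (+<+ n<r) r∣u-v =
  ℕ.>⇒∤ {{>-nonZero (ℕ.m<n⇒0<n∸m m<n)}} (ℕ.≤-<-trans (ℕ.m∸n≤m n m) n<r)
    (subst (r ℕ.∣_) ∣m-n∣≡n∸m r∣u-v)
  where
  ∣m-n∣≡n∸m : ℤ.∣ + m -ℤ + n ∣ ≡ n ∸ m
  ∣m-n∣≡n∸m = trans (cong ℤ.∣_∣ (ℤ.m-n≡m⊖n m n)) (ℤ.∣⊖∣-< m<n)

distinctMod-sym : ∀ r {u v} → DistinctMod r u v → DistinctMod r v u
distinctMod-sym r {u} {v} ¬r∣u-v r∣v-u =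
  ¬r∣u-v (subst (r ℕ.∣_) (ℤ.∣i-j∣≡∣j-i∣ v u) r∣v-u)

sumFrom-suc : ∀ m k f → sumFrom m (suc k) f ≡ sumFrom m k f +ℤ f (m + k)
sumFrom-suc m zero    f = begin
  f m +ℤ +0          ≡⟨ ℤ.+-comm (f m) +0 ⟩
  +0 +ℤ f m          ≡⟨ cong (λ t → +0 +ℤ f t) (sym (ℕ.+-identityʳ m)) ⟩
  +0 +ℤ f (m + 0)    ∎
  where open ≡-Reasoning
sumFrom-suc m (suc k) f = begin
  f m +ℤ sumFrom (suc m) (suc k) f  ≡⟨ cong (f m +ℤ_) (sumFrom-suc (suc m) k f) ⟩
  f m +ℤ (S +ℤ f (suc m + k))       ≡⟨ ℤ.+-assoc (f m) S _ ⟨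
  f m +ℤ S +ℤ f (suc m + k)         ≡⟨ cong (λ t → f m +ℤ S +ℤ f t) (ℕ.+-suc m k) ⟨
  f m +ℤ S +ℤ f (m + suc k)         ∎
  where
  open ≡-Reasoning
  S = sumFrom (suc m) k f

[i+j]-[k+l]≡[i-k]+[j-l] : ∀ i j k l → (i +ℤ j) -ℤ (k +ℤ l) ≡ (i -ℤ k) +ℤ (j -ℤ l)
[i+j]-[k+l]≡[i-k]+[j-l] = solve-∀

m+i-[j+k]≡[i-j]+[m-k] : ∀ m i j k → m +ℤ i -ℤ (j +ℤ k) ≡ (i -ℤ j) +ℤ (m -ℤ k)
m+i-[j+k]≡[i-j]+[m-k] = solve-∀

i+[m-k]≡i+[l-k]+[m-l] : ∀ i m k l → i +ℤ (m -ℤ k) ≡ i +ℤ (l -ℤ k) +ℤ (m -ℤ l)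
i+[m-k]≡i+[l-k]+[m-l] = solve-∀

module _ (a : ℕ → ℕ) where

  private
    even odd : ℕ → ℤ
    even j = + a (2 * j)
    odd  j = + a (suc (2 * j))

  xval-suc : ∀ i → xval a (suc i) ≡ xval a i +ℤ (+ a (2 * suc i) -ℤ + a (suc (2 * i)))
  xval-suc i = begin
    sumFrom 1 (suc i) even -ℤ sumFrom 0 (suc i) odd
      ≡⟨ cong₂ _-ℤ_ (sumFrom-suc 1 i even) (sumFrom-suc 0 i odd) ⟩
    (E +ℤ even (suc i)) -ℤ (O +ℤ odd i)
      ≡⟨ [i+j]-[k+l]≡[i-k]+[j-l] E (even (suc i)) O (odd i) ⟩
    (E -ℤ O) +ℤ (even (suc i) -ℤ odd i) ∎
    where
    open ≡-Reasoning
    E = sumFrom 1 i even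
    O = sumFrom 0 i odd

  module _ (r : ℕ) where

    yval-zero : yval r a 0 ≡ + r
    yval-zero = trans (ℤ.+-identityʳ _) (ℤ.+-identityʳ (+ r))

    yval-suc : ∀ i → yval r a (suc i) ≡ xval a i +ℤ (+ r -ℤ + a (suc (2 * i)))
    yval-suc zero    = sym (ℤ.+-identityˡ _)
    yval-suc (suc i) = begin
      + r +ℤ E -ℤ sumFrom 0 (suc (suc i)) odd
        ≡⟨ cong (+ r +ℤ E -ℤ_) (sumFrom-suc 0 (suc i) odd) ⟩
      + r +ℤ E -ℤ (O +ℤ odd (suc i))
        ≡⟨ m+i-[j+k]≡[i-j]+[m-k] (+ r) E O (odd (suc i)) ⟩
      (E -ℤ O) +ℤ (+ r -ℤ odd (suc i)) ∎
      where
      open ≡-Reasoning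
      E = sumFrom 1 (suc i) even
      O = sumFrom 0 (suc i) odd

    yval-suc′ : ∀ i → yval r a (suc i) ≡ xval a (suc i) +ℤ (+ r -ℤ + a (2 * suc i))
    yval-suc′ i = begin
      yval r a (suc i)                         ≡⟨ yval-suc i ⟩
      xval a i +ℤ (+ r -ℤ o)                   ≡⟨ i+[m-k]≡i+[l-k]+[m-l] (xval a i) (+ r) o e ⟩
      xval a i +ℤ (e -ℤ o) +ℤ (+ r -ℤ e)       ≡⟨ cong (_+ℤ (+ r -ℤ e)) (xval-suc i) ⟨
      xval a (suc i) +ℤ (+ r -ℤ e)             ∎
      where
      open ≡-Reasoning
      e = + a (2 * suc i)
      o = + a (suc (2 * i))

module _ (r s : ℕ) (2s+1≤r : 2 * s + 1 ≤ r) (a : ℕ → ℕ)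
         (a-range : ∀ i → 1 ≤ i → i ≤ 2 * s → 1 ≤ a i × a i ≤ r ∸ 1)
         (a-increasing : ∀ i → 1 ≤ i → i + 1 ≤ 2 * s → a i < a (suc i)) where

  private
    x y : ℕ → ℤ
    x = xval a
    y = yval r a

  0<r : 0 < r
  0<r = ℕ.≤-trans (ℕ.m≤n+m 1 (2 * s)) 2s+1≤r

  a<r : ∀ {i} → 1 ≤ i → i ≤ 2 * s → a i < r
  a<r {i} 1≤i i≤2s = m≤n∸1⇒m<n 0<r (proj₂ (a-range i 1≤i i≤2s))

  a-step : ∀ {i} → 1 ≤ i → i < 2 * s → a i < a (suc i)
  a-step {i} 1≤i i<2s = a-increasing i 1≤i (subst (_≤ 2 * s) (ℕ.+-comm 1 i) i<2s)

  a-odd<even : ∀ {k} → k < s → a (suc (2 * k)) < a (2 * suc k)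
  a-odd<even {k} k<s = subst (λ n → a (suc (2 * k)) < a n) (sym (ℕ.*-suc 2 k))
    (a-step (s≤s z≤n) (subst (_≤ 2 * s) (ℕ.*-suc 2 k) (ℕ.*-monoʳ-≤ 2 k<s)))

  a-even<odd : ∀ {k} → suc k < s → a (2 * suc k) < a (suc (2 * suc k))
  a-even<odd {k} 1+k<s =
    a-step (s≤s z≤n) (ℕ.<-≤-trans (ℕ.*-monoʳ-< 2 (ℕ.n<1+n (suc k))) (ℕ.*-monoʳ-≤ 2 1+k<s))

  x-step : ∀ {k} → k < s → x k <ℤ x (suc k)
  x-step {k} k<s =
    subst (x k <ℤ_) (sym (xval-suc a k)) (0<j⇒i<i+j (x k) (m<n⇒0<n-m (a-odd<even k<s)))

  y-step : ∀ {k} → k < s → y (suc k) <ℤ y k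
  y-step {zero} 0<s =
    subst (+ r -ℤ + a 1 <ℤ_) (trans (ℤ.+-identityʳ (+ r)) (sym (yval-zero a r)))
      (m<n⇒k-n<k-m (+ r) (proj₁ (a-range 1 ℕ.≤-refl (ℕ.≤-trans 0<s (ℕ.m≤n*m s 2)))))
  y-step {suc k} 1+k<s = begin-strict
    y (suc (suc k))
      ≡⟨ yval-suc a r (suc k) ⟩
    x (suc k) +ℤ (+ r -ℤ + a (suc (2 * suc k)))
      <⟨ ℤ.+-monoʳ-< (x (suc k)) (m<n⇒k-n<k-m (+ r) (a-even<odd 1+k<s)) ⟩
    x (suc k) +ℤ (+ r -ℤ + a (2 * suc k))
      ≡⟨ yval-suc′ a r k ⟨
    y (suc k) ∎
    where open ℤ.≤-Reasoning

  xₖ<yₖ : ∀ {k} → k ≤ s → x k <ℤ y k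
  xₖ<yₖ {zero}  _     = subst (+0 <ℤ_) (sym (yval-zero a r)) (+<+ 0<r)
  xₖ<yₖ {suc k} 1+k≤s = subst (x (suc k) <ℤ_) (sym (yval-suc′ a r k))
    (0<j⇒i<i+j (x (suc k)) (m<n⇒0<n-m (a<r (s≤s z≤n) (ℕ.*-monoʳ-≤ 2 1+k≤s))))

  x-increasing : ∀ {i j} → i < j → j ≤ s → x i <ℤ x j
  x-increasing i<j j≤s =
    stepwise⇒pairwise {R = _<ℤ_} ℤ.<-trans {f = x} (x-step ∘ s<s⁻¹) i<j (s≤s j≤s)

  y-decreasing : ∀ {i j} → i < j → j ≤ s → y j <ℤ y i
  y-decreasing i<j j≤s =
    stepwise⇒pairwise {R = flip _<ℤ_} (flip ℤ.<-trans) {f = y} (y-step ∘ s<s⁻¹) i<j (s≤s j≤s)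

  x-monotone : ∀ {i j} → i ≤ j → j ≤ s → x i ≤ℤ x j
  x-monotone i≤j j≤s with ℕ.m≤n⇒m<n∨m≡n i≤j
  ... | inj₁ i<j  = ℤ.<⇒≤ (x-increasing i<j j≤s)
  ... | inj₂ refl = ℤ.≤-refl

  y-antitone : ∀ {i j} → i ≤ j → j ≤ s → y j ≤ℤ y i
  y-antitone i≤j j≤s with ℕ.m≤n⇒m<n∨m≡n i≤j
  ... | inj₁ i<j  = ℤ.<⇒≤ (y-decreasing i<j j≤s)
  ... | inj₂ refl = ℤ.≤-refl

  x<y : ∀ {i j} → i ≤ s → j ≤ s → x i <ℤ y j
  x<y i≤s j≤s =
    ℤ.≤-<-trans (x-monotone i≤s ℕ.≤-refl)
      (ℤ.<-≤-trans (xₖ<yₖ ℕ.≤-refl) (y-antitone j≤s ℕ.≤-refl))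

  0≤x : ∀ {i} → i ≤ s → +0 ≤ℤ x i
  0≤x = x-monotone z≤n

  0≤y : ∀ {j} → j ≤ s → +0 ≤ℤ y j
  0≤y j≤s = ℤ.<⇒≤ (x<y z≤n j≤s)

  x<r : ∀ {i} → i ≤ s → x i <ℤ + r
  x<r {i} i≤s = subst (x i <ℤ_) (yval-zero a r) (x<y i≤s z≤n)

  y<r : ∀ {j} → 0 < j → j ≤ s → y j <ℤ + r
  y<r {j} 0<j j≤s = subst (y j <ℤ_) (yval-zero a r) (y-decreasing 0<j j≤s)

  chain-sorted : AllPairs _<ℤ_ (chain r a s)
  chain-sorted = AllPairs.++⁺ lower upper between
    where
    lower : AllPairs _<ℤ_ (+ 0 ∷ xs a s)
    lower = All-map-upTo⁺ (x-increasing (s≤s z≤n))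
      AllPairs.∷ AllPairs-map-upTo⁺ (λ i<j → x-increasing (s≤s i<j))

    upper : AllPairs _<ℤ_ (ysRev r a s ++ [ + r ])
    upper = AllPairs.++⁺
      (AllPairs-map-upTo⁺ (λ {i} i<j j<s →
        y-decreasing (ℕ.∸-monoʳ-< i<j (ℕ.<⇒≤ j<s)) (ℕ.m∸n≤m s i)))
      (All.[] AllPairs.∷ AllPairs.[])
      (All-map-upTo⁺ (λ {i} i<s → y<r (ℕ.m<n⇒0<n∸m i<s) (ℕ.m∸n≤m s i) All.∷ All.[]))

    below-upper : ∀ {i} → i ≤ s → All (x i <ℤ_) (ysRev r a s ++ [ + r ])
    below-upper i≤s =
      All.++⁺ (All-map-upTo⁺ (λ {j} _ → x<y i≤s (ℕ.m∸n≤m s j))) (x<r i≤s All.∷ All.[])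

    between : All (λ u → All (u <ℤ_) (ysRev r a s ++ [ + r ])) (+ 0 ∷ xs a s)
    between = below-upper z≤n All.∷ All-map-upTo⁺ below-upper

  points-distinctMod : AllPairs (DistinctMod r) (points r a s)
  points-distinctMod =
    All.++⁺ (All-map-upTo⁺ (x-x (s≤s z≤n))) (All-map-upTo⁺ (x-y z≤n (s≤s z≤n)))
    AllPairs.∷ AllPairs.++⁺
      (AllPairs-map-upTo⁺ (λ i<j → x-x (s≤s i<j)))
      (AllPairs-map-upTo⁺ (λ i<j → y-y (s≤s z≤n) (s≤s i<j)))
      (All-map-upTo⁺ (λ i<s → All-map-upTo⁺ (x-y i<s (s≤s z≤n))))
    where
    x-x : ∀ {i j} → i < j → j ≤ s → DistinctMod r (x i) (x j)
    x-x i<j j≤s =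
      distinctMod-< r (0≤x (ℕ.<⇒≤ (ℕ.<-≤-trans i<j j≤s))) (x-increasing i<j j≤s) (x<r j≤s)

    y-y : ∀ {i j} → 0 < i → i < j → j ≤ s → DistinctMod r (y i) (y j)
    y-y {i} {j} 0<i i<j j≤s = distinctMod-sym r {y j} {y i}
      (distinctMod-< r (0≤y j≤s) (y-decreasing i<j j≤s)
        (y<r 0<i (ℕ.<⇒≤ (ℕ.<-≤-trans i<j j≤s))))

    x-y : ∀ {i j} → i ≤ s → 0 < j → j ≤ s → DistinctMod r (x i) (y j)
    x-y i≤s 0<j j≤s = distinctMod-< r (0≤x i≤s) (x<y i≤s j≤s) (y<r 0<j j≤s)

lemma4 : (r s : ℕ) → 2 * s + 1 ≤ r → (a : ℕ → ℕ)
    → (∀ i → 1 ≤ i → i ≤ 2 * s → 1 ≤ a i × a i ≤ r ∸ 1)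
    → (∀ i → 1 ≤ i → i + 1 ≤ 2 * s → a i < a (suc i))
    → Linked _<ℤ_ (chain r a s) × AllPairs (DistinctMod r) (points r a s)
lemma4 r s 2s+1≤r a a-range a-increasing =
  AllPairs⇒Linked (chain-sorted r s 2s+1≤r a a-range a-increasing) ,
  points-distinctMod r s 2s+1≤r a a-range a-increasing
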